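{- Let $n\ge 4$. In the group algebra $\mathbb{Z}[D_n]$ define $\Psi_1 = 1+s_1+s_{\bar 1}+s_1s_{\bar 1}$ and, for $2\le i\le n-1$, \[ \Psi_i = 1 + s_i\cdot\Psi_{i-1} + s_i s_{i-1}\cdots s_2 s_1 s_{\bar 1} s_2\cdots s_i. \] Then $\Psi_1\Psi_2\cdots\Psi_{n-1} = \sum_{w\in D_n} w$.
   Context: $B_n$ is the group of signed permutations of $\{\pm1,\ldots,\pm n\}$ (bijections with $w(-i)=-w(i)$), product $(uv)(x)=u(v(x))$, written $w=w_1\cdots w_n$ with $w_i=w(i)$. $D_n$ is the subgroup of $B_n$ of elements with an even number of negative entries among $w_1,\ldots,w_n$. For $1\le i\le n-1$, $s_i$ exchanges $i\leftrightarrow i+1$ and $-i\leftrightarrow-(i+1)$, fixing the rest; $s_{\bar 1}$ exchanges $-1\leftrightarrow 2$ and $1\leftrightarrow -2$, fixing the rest. -}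

module Defs where

open import Data.Nat as ℕ using (ℕ; zero; suc; _≡ᵇ_; _∸_; _%_)
open import Data.Integer as ℤ using (ℤ; +_; -[1+_]; ∣_∣; _<?_)
open import Data.Fin using (Fin; toℕ)
open import Data.Bool using (if_then_else_)
open import Data.List as L using (List; []; _∷_; _++_; concatMap; filter; length)
open import Data.Vec as V using (Vec; tabulate; lookup; toList)
open import Data.Vec.Properties using (≡-dec)
open import Data.Product using (_×_; _,_)
open import Relation.Nullary using (yes; no; ¬_)
open import Relation.Binary.PropositionalEquality using (_≡_)

-- A (candidate) signed permutation of {±1,…,±n}, in one-line notation
-- w = w₁ ⋯ wₙ with wᵢ = w(i) (position i is index i-1 of the vector).
SP : ℕ → Set
SP n = Vec ℤ n

IsSignedPerm : ∀ {n} → SP n → Set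
IsSignedPerm {n} w =
  (∀ j → (1 ℕ.≤ ∣ lookup w j ∣) × (∣ lookup w j ∣ ℕ.≤ n)) ×
  (∀ j k → ∣ lookup w j ∣ ≡ ∣ lookup w k ∣ → j ≡ k)

negCount : ∀ {n} → SP n → ℕ
negCount w = length (filter (λ x → x <? + 0) (toList w))

InD : ∀ {n} → SP n → Set
InD w = IsSignedPerm w × (negCount w % 2 ≡ 0)

nth : List ℤ → ℕ → ℤ
nth [] _ = + 0
nth (x ∷ xs) zero = x
nth (x ∷ xs) (suc k) = nth xs k

-- action of w on a signed integer x, using w(-i) = -w(i)
act : ∀ {n} → SP n → ℤ → ℤ
act w (+ zero) = + 0
act w (+ suc k) = nth (toList w) k
act w -[1+ k ] = ℤ.- nth (toList w) k

-- product (uv)(x) = u(v(x))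
_∘ₛ_ : ∀ {n} → SP n → SP n → SP n
u ∘ₛ v = V.map (act u) v

idₛ : ∀ {n} → SP n
idₛ = tabulate (λ j → + suc (toℕ j))

s : ∀ {n} → ℕ → SP n
s i = tabulate (λ j → let k = suc (toℕ j) in
        if k ≡ᵇ i then + suc i else if k ≡ᵇ suc i then + i else + k)

-- s_{1̄}: exchanges -1 ↔ 2 and 1 ↔ -2, i.e. one-line (-2)(-1)3⋯n
s̄₁ : ∀ {n} → SP n
s̄₁ = tabulate (λ j → if toℕ j ≡ᵇ 0 then -[1+ 1 ]
                      else if toℕ j ≡ᵇ 1 then -[1+ 0 ] else + suc (toℕ j))

-- Group algebra ℤ[B_n] (containing ℤ[D_n]): formal ℤ-linear combinations,
-- compared through their coefficient functions.
ZG : ℕ → Set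
ZG n = List (ℤ × SP n)

coeff : ∀ {n} → ZG n → SP n → ℤ
coeff [] w = + 0
coeff ((c , v) ∷ xs) w with ≡-dec ℤ._≟_ v w
... | yes _ = c ℤ.+ coeff xs w
... | no _ = coeff xs w

gen : ∀ {n} → SP n → ZG n
gen g = (+ 1 , g) ∷ []

𝟙 : ∀ {n} → ZG n
𝟙 = gen idₛ

_+ᴳ_ : ∀ {n} → ZG n → ZG n → ZG n
_+ᴳ_ = _++_

_*ᴳ_ : ∀ {n} → ZG n → ZG n → ZG n
x *ᴳ y = concatMap (λ { (a , u) → L.map (λ { (b , v) → (a ℤ.* b , u ∘ₛ v) }) y }) x

infixl 6 _+ᴳ_
infixl 7 _*ᴳ_

down : ∀ {n} → ℕ → SP n
down zero = idₛ
down (suc k) = s (suc k) ∘ₛ down k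

up : ∀ {n} → ℕ → SP n
up zero = idₛ
up (suc zero) = idₛ
up (suc (suc k)) = up (suc k) ∘ₛ s (suc (suc k))

-- Ψ_i (only i ≥ 1 is meaningful; Ψ 0 is an unused placeholder)
Ψ : ∀ {n} → ℕ → ZG n
Ψ zero = 𝟙
Ψ (suc zero) = 𝟙 +ᴳ gen (s 1) +ᴳ gen s̄₁ +ᴳ gen (s 1 ∘ₛ s̄₁)
Ψ (suc (suc k)) = let i = suc (suc k) in
  𝟙 +ᴳ gen (s i) *ᴳ Ψ (suc k) +ᴳ gen ((down i ∘ₛ s̄₁) ∘ₛ up i)

prodΨ : ∀ {n} → ℕ → ZG n
prodΨ zero = 𝟙
prodΨ (suc k) = prodΨ k *ᴳ Ψ (suc k)

module Submission where

-- Write D_k ⊆ D_n for the elements fixing k+1, …, n. The terms of Ψ_k all have coefficient 1, lie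
-- in D_{k+1}, and their inverses send k+1 to each of ±1, …, ±(k+1) exactly once. By induction on k,
-- Ψ_1 ⋯ Ψ_k is therefore the sum of the elements of D_{k+1}: an element w of D_{k+2} is u r, with
-- u ∈ D_{k+1} and r a term of Ψ_{k+1}, for exactly one r (the one with r⁻¹(k+2) = w⁻¹(k+2)), while
-- u r never leaves D_{k+2}.

open import Defs
open import Data.Nat as ℕ using (ℕ; zero; suc; _≡ᵇ_; _%_; _<_; _≤_; z≤n; s≤s; _+_; _∸_)
import Data.Nat.Properties as ℕP
open import Data.Nat.DivMod using ([m+n]%n≡m%n)
open import Data.Integer as ℤ using (ℤ; +_; -[1+_]; ∣_∣; _<?_)
import Data.Integer.Properties as ℤP
open import Data.Fin as F using (Fin; toℕ; fromℕ<)
import Data.Fin.Properties as FP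
open import Data.Bool using (true; false; if_then_else_)
open import Data.Bool.Properties using (if-float; if-cong-else)
open import Data.List as L using (List; []; _∷_; _++_; concatMap)
import Data.List.Properties as LP
open import Data.List.Relation.Unary.All as All using (All; []; _∷_)
import Data.List.Relation.Unary.All.Properties as AllP
open import Data.Vec as V using (Vec; tabulate; lookup; toList)
open import Data.Vec.Properties using (≡-dec)
open import Data.Product using (_×_; _,_; proj₁; proj₂; ∃-syntax; uncurry)
open import Data.Sum using (_⊎_; inj₁; inj₂)
open import Data.Empty using (⊥-elim)
open import Function using (_∘_)
open import Function.Definitions using (Injective)
open import Relation.Nullary using (Dec; yes; no; ¬_; does)
open import Relation.Binary.PropositionalEquality
open import Algebra.Properties.CommutativeSemigroup ℕP.+-commutativeSemigroup using (interchange; x∙yz≈y∙xz)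

act-neg : ∀ {n} (u : SP n) x → act u (ℤ.- x) ≡ ℤ.- act u x
act-neg u (+ zero) = refl
act-neg u (+ suc k) = refl
act-neg u -[1+ k ] = sym (ℤP.neg-involutive _)

nth-toList-map : ∀ {n} (g : ℤ → ℤ) → g (+ 0) ≡ + 0 → (v : Vec ℤ n) → ∀ k →
  nth (toList (V.map g v)) k ≡ g (nth (toList v) k)
nth-toList-map g g0 V.[] k = sym g0
nth-toList-map g g0 (x V.∷ v) zero = refl
nth-toList-map g g0 (x V.∷ v) (suc k) = nth-toList-map g g0 v k

act-∘ₛ : ∀ {n} (u v : SP n) y → act (u ∘ₛ v) y ≡ act u (act v y)
act-∘ₛ u v (+ zero) = refl
act-∘ₛ u v (+ suc k) = nth-toList-map (act u) refl v k
act-∘ₛ u v -[1+ k ] =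
  trans (cong ℤ.-_ (nth-toList-map (act u) refl v k)) (sym (act-neg u (nth (toList v) k)))

act-∘ₛ₃ : ∀ {n} (u v x : SP n) y → act ((u ∘ₛ v) ∘ₛ x) y ≡ act u (act v (act x y))
act-∘ₛ₃ u v x y = trans (act-∘ₛ (u ∘ₛ v) x y) (act-∘ₛ u v (act x y))

SP-ext : ∀ {n} (u v : SP n) → (∀ m → m < n → act u (+ suc m) ≡ act v (+ suc m)) → u ≡ v
SP-ext V.[] V.[] eq = refl
SP-ext (x V.∷ u) (y V.∷ v) eq =
  cong₂ V._∷_ (eq 0 (s≤s z≤n)) (SP-ext u v (λ m m<n → eq (suc m) (s≤s m<n)))

∘ₛ-assoc : ∀ {n} (u v x : SP n) → (u ∘ₛ v) ∘ₛ x ≡ u ∘ₛ (v ∘ₛ x)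
∘ₛ-assoc u v x = SP-ext _ _ λ m _ → begin
  act ((u ∘ₛ v) ∘ₛ x) (+ suc m)    ≡⟨ act-∘ₛ₃ u v x (+ suc m) ⟩
  act u (act v (act x (+ suc m)))  ≡⟨ cong (act u) (act-∘ₛ v x (+ suc m)) ⟨
  act u (act (v ∘ₛ x) (+ suc m))   ≡⟨ act-∘ₛ u (v ∘ₛ x) (+ suc m) ⟨
  act (u ∘ₛ (v ∘ₛ x)) (+ suc m)    ∎
  where open ≡-Reasoning

act-tabulate : ∀ {n} (g : Fin n → ℤ) m (m<n : m < n) → act (tabulate g) (+ suc m) ≡ g (fromℕ< m<n)
act-tabulate {suc n} g zero m<n = refl
act-tabulate {suc n} g (suc m) (s≤s m<n) = act-tabulate (g ∘ F.suc) m m<n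

act-idₛ : ∀ {n} m → m < n → act (idₛ {n}) (+ suc m) ≡ + suc m
act-idₛ m m<n = trans (act-tabulate _ m m<n) (cong (+_ ∘ suc) (FP.toℕ-fromℕ< m<n))

∘ₛ-identityʳ : ∀ {n} (u : SP n) → u ∘ₛ idₛ ≡ u
∘ₛ-identityʳ u = SP-ext _ _ λ m m<n → trans (act-∘ₛ u idₛ (+ suc m)) (cong (act u) (act-idₛ m m<n))

infix 4 _∈±_
data _∈±_ : ℤ → ℕ → Set where
  pos : ∀ {m n} → m < n → + suc m ∈± n
  neg : ∀ {m n} → m < n → -[1+ m ] ∈± n

∈±-neg : ∀ {x n} → x ∈± n → ℤ.- x ∈± n
∈±-neg (pos m<n) = neg m<n
∈±-neg (neg m<n) = pos m<n

∈±-mono : ∀ {x m n} → m ≤ n → x ∈± m → x ∈± n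
∈±-mono m≤n (pos k<m) = pos (ℕP.<-≤-trans k<m m≤n)
∈±-mono m≤n (neg k<m) = neg (ℕP.<-≤-trans k<m m≤n)

∈±-abs : ∀ {x n} → x ∈± n → ∃[ j ] j < n × ∣ x ∣ ≡ suc j
∈±-abs (pos {m} m<n) = m , m<n , refl
∈±-abs (neg {m} m<n) = m , m<n , refl

abs⇒∈± : ∀ x {j n} → ∣ x ∣ ≡ suc j → j < n → x ∈± n
abs⇒∈± (+ suc m) refl j<n = pos j<n
abs⇒∈± -[1+ m ] refl j<n = neg j<n

bounds⇒∈± : ∀ x {n} → 1 ≤ ∣ x ∣ → ∣ x ∣ ≤ n → x ∈± n
bounds⇒∈± (+ suc m) _ m<n = pos m<n
bounds⇒∈± -[1+ m ] _ m<n = neg m<n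

∈±-cong-abs : ∀ {x y n} → ∣ x ∣ ≡ ∣ y ∣ → y ∈± n → x ∈± n
∈±-cong-abs {x} x≈y y∈ with ∈±-abs y∈
... | j , j<n , ∣y∣≡ = abs⇒∈± x (trans x≈y ∣y∣≡) j<n

∈±-sign : ∀ {x n L} → x ∈± n → ∣ x ∣ ≡ suc L → (x ≡ + suc L) ⊎ (x ≡ -[1+ L ])
∈±-sign (pos _) refl = inj₁ refl
∈±-sign (neg _) refl = inj₂ refl

∈±-self-neg : ∀ {x n} → x ∈± n → x ≢ ℤ.- x
∈±-self-neg (pos _) ()
∈±-self-neg (neg _) ()

act-idₛ-∈± : ∀ {n y} → y ∈± n → act (idₛ {n}) y ≡ y
act-idₛ-∈± (pos {m} m<n) = act-idₛ m m<n
act-idₛ-∈± (neg {m} m<n) = cong ℤ.-_ (act-idₛ m m<n)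

act-∈± : ∀ {n} (u : SP n) → (∀ m → m < n → act u (+ suc m) ∈± n) →
  ∀ y → y ∈± n → act u y ∈± n
act-∈± u maps (+ suc m) (pos m<n) = maps m m<n
act-∈± u maps -[1+ m ] (neg m<n) = ∈±-neg (maps m m<n)

act-inverse-∈± : ∀ {n} (u v : SP n) → (∀ m → m < n → act u (act v (+ suc m)) ≡ + suc m) →
  ∀ y → y ∈± n → act u (act v y) ≡ y
act-inverse-∈± u v inv (+ suc m) (pos m<n) = inv m m<n
act-inverse-∈± u v inv -[1+ m ] (neg m<n) = trans (act-neg u (act v (+ suc m))) (cong ℤ.-_ (inv m m<n))

if-float₂ : ∀ {A B : Set} (f : A → B) b c {x y z : A} →
  f (if b then x else if c then y else z) ≡ (if b then f x else if c then f y else f z)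
if-float₂ f b c = trans (if-float f b) (if-cong-else b (if-float f c))

swap : ℕ → ℕ → ℕ
swap zero zero = 1
swap zero (suc zero) = 0
swap zero (suc (suc m)) = suc (suc m)
swap (suc a) zero = 0
swap (suc a) (suc m) = suc (swap a m)

swap-if : ∀ a m → swap a m ≡ (if m ≡ᵇ a then suc a else if m ≡ᵇ suc a then a else m)
swap-if zero zero = refl
swap-if zero (suc zero) = refl
swap-if zero (suc (suc m)) = refl
swap-if (suc a) zero = refl
swap-if (suc a) (suc m) = trans (cong suc (swap-if a m)) (if-float₂ suc (m ≡ᵇ a) (m ≡ᵇ suc a))

swap-involutive : ∀ a m → swap a (swap a m) ≡ m
swap-involutive zero zero = refl
swap-involutive zero (suc zero) = refl
swap-involutive zero (suc (suc m)) = refl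
swap-involutive (suc a) zero = refl
swap-involutive (suc a) (suc m) = cong suc (swap-involutive a m)

swap-< : ∀ {n} a m → suc a < n → m < n → swap a m < n
swap-< zero zero (s≤s (s≤s _)) _ = s≤s (s≤s z≤n)
swap-< zero (suc zero) _ (s≤s _) = s≤s z≤n
swap-< zero (suc (suc m)) _ m<n = m<n
swap-< (suc a) zero _ m<n = m<n
swap-< {suc n} (suc a) (suc m) (s≤s a<n) (s≤s m<n) = s≤s (swap-< a m a<n m<n)

swap-fixes : ∀ a m → suc a < m → swap a m ≡ m
swap-fixes zero (suc (suc m)) _ = refl
swap-fixes zero (suc zero) (s≤s ())
swap-fixes (suc a) (suc m) (s≤s a<m) = cong suc (swap-fixes a m a<m)

swap-left : ∀ a → swap a a ≡ suc a
swap-left zero = refl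
swap-left (suc a) = cong suc (swap-left a)

swap-right : ∀ a → swap a (suc a) ≡ a
swap-right zero = refl
swap-right (suc a) = cong suc (swap-right a)

act-s : ∀ {n} a m → m < n → act (s {n} (suc a)) (+ suc m) ≡ + suc (swap a m)
act-s {n} a m m<n = begin
    act (s {n} (suc a)) (+ suc m)
  ≡⟨ act-tabulate _ m m<n ⟩
    entry (toℕ (fromℕ< m<n))
  ≡⟨ cong entry (FP.toℕ-fromℕ< m<n) ⟩
    entry m
  ≡⟨ if-float₂ (+_ ∘ suc) (m ≡ᵇ a) (m ≡ᵇ suc a) ⟨
    + suc (if m ≡ᵇ a then suc a else if m ≡ᵇ suc a then a else m)
  ≡⟨ cong (+_ ∘ suc) (swap-if a m) ⟨
    + suc (swap a m)
  ∎
  where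
  open ≡-Reasoning
  entry : ℕ → ℤ
  entry k = if suc k ≡ᵇ suc a then + suc (suc a) else if suc k ≡ᵇ suc (suc a) then + suc a else + suc k

s-fixes : ∀ {n} a m → suc a < m → m < n → act (s {n} (suc a)) (+ suc m) ≡ + suc m
s-fixes a m a<m m<n = trans (act-s a m m<n) (cong (+_ ∘ suc) (swap-fixes a m a<m))

s-∈± : ∀ {n} a → suc a < n → ∀ y → y ∈± n → act (s {n} (suc a)) y ∈± n
s-∈± a a<n = act-∈± _ λ m m<n → subst (_∈± _) (sym (act-s a m m<n)) (pos (swap-< a m a<n m<n))

s-involutive : ∀ {n} a → suc a < n → ∀ y → y ∈± n → act (s {n} (suc a)) (act (s (suc a)) y) ≡ y
s-involutive {n} a a<n = act-inverse-∈± _ _ λ m m<n → begin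
  act σ (act σ (+ suc m))                      ≡⟨ cong (act σ) (act-s a m m<n) ⟩
  act σ (+ suc (swap a m))                     ≡⟨ act-s a (swap a m) (swap-< a m a<n m<n) ⟩
  + suc (swap a (swap a m))                    ≡⟨ cong (+_ ∘ suc) (swap-involutive a m) ⟩
  + suc m                                      ∎
  where
  open ≡-Reasoning
  σ = s {n} (suc a)

sum< : ℕ → (ℕ → ℕ) → ℕ
sum< zero g = 0
sum< (suc n) g = g 0 + sum< n (g ∘ suc)

sum<-cong : ∀ n (g h : ℕ → ℕ) → (∀ m → m < n → g m ≡ h m) → sum< n g ≡ sum< n h
sum<-cong zero g h eq = refl
sum<-cong (suc n) g h eq = cong₂ _+_ (eq 0 (s≤s z≤n)) (sum<-cong n _ _ λ m m<n → eq (suc m) (s≤s m<n))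

sum<-zero : ∀ n → sum< n (λ _ → 0) ≡ 0
sum<-zero zero = refl
sum<-zero (suc n) = sum<-zero n

sum<-swap : ∀ n a (g : ℕ → ℕ) → suc a < n → sum< n (g ∘ swap a) ≡ sum< n g
sum<-swap (suc (suc n)) zero g _ = x∙yz≈y∙xz (g 1) (g 0) (sum< n (g ∘ suc ∘ suc))
sum<-swap (suc n) (suc a) g (s≤s a<n) = cong (λ z → g 0 + z) (sum<-swap n a (g ∘ suc) a<n)

negBit : ℤ → ℕ
negBit x = if does (x <? + 0) then 1 else 0

negatives : ∀ {n} → SP n → ℕ
negatives {n} v = sum< n (λ m → negBit (act v (+ suc m)))

record InD′ {n} (v : SP n) : Set where
  constructor inD′
  field
    range     : ∀ m → m < n → act v (+ suc m) ∈± n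
    injective : ∀ m m' → m < n → m' < n → ∣ act v (+ suc m) ∣ ≡ ∣ act v (+ suc m') ∣ → m ≡ m'
    even      : negatives v % 2 ≡ 0

lookup≡act : ∀ {n} (w : SP n) j → lookup w j ≡ act w (+ suc (toℕ j))
lookup≡act (x V.∷ w) F.zero = refl
lookup≡act (x V.∷ w) (F.suc j) = lookup≡act w j

negCount≡negatives : ∀ {n} (w : SP n) → negCount w ≡ negatives w
negCount≡negatives V.[] = refl
negCount≡negatives (x V.∷ w) with does (x <? + 0) | negCount≡negatives w
... | true  | eq = cong suc eq
... | false | eq = eq

InD→InD′ : ∀ {n} (w : SP n) → InD w → InD′ w
InD→InD′ {n} w ((bounds , injF) , par) =
  inD′ range injective (trans (cong (_% 2) (sym (negCount≡negatives w))) par)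
  where
  lookup-fromℕ< : ∀ m (m<n : m < n) → lookup w (fromℕ< m<n) ≡ act w (+ suc m)
  lookup-fromℕ< m m<n = trans (lookup≡act w _) (cong (act w ∘ +_ ∘ suc) (FP.toℕ-fromℕ< m<n))
  range : ∀ m → m < n → act w (+ suc m) ∈± n
  range m m<n = subst (_∈± n) (lookup-fromℕ< m m<n) (uncurry (bounds⇒∈± _) (bounds (fromℕ< m<n)))
  injective : ∀ m m' → m < n → m' < n → ∣ act w (+ suc m) ∣ ≡ ∣ act w (+ suc m') ∣ → m ≡ m'
  injective m m' m<n m'<n eq = begin
    m                       ≡⟨ FP.toℕ-fromℕ< m<n ⟨
    toℕ (fromℕ< m<n)         ≡⟨ cong toℕ (injF _ _ (trans (cong ∣_∣ (lookup-fromℕ< m m<n))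
                                 (trans eq (sym (cong ∣_∣ (lookup-fromℕ< m' m'<n)))))) ⟩
    toℕ (fromℕ< m'<n)        ≡⟨ FP.toℕ-fromℕ< m'<n ⟩
    m'                      ∎
    where open ≡-Reasoning

InD′→InD : ∀ {n} (w : SP n) → InD′ w → InD w
InD′→InD {n} w (inD′ range injective even) =
  (bounds , injF) , trans (cong (_% 2) (negCount≡negatives w)) even
  where
  bounds : ∀ j → (1 ≤ ∣ lookup w j ∣) × (∣ lookup w j ∣ ≤ n)
  bounds j with ∈±-abs (range (toℕ j) (FP.toℕ<n j))
  ... | k , k<n , eq rewrite lookup≡act w j | eq = s≤s z≤n , k<n
  injF : ∀ j k → ∣ lookup w j ∣ ≡ ∣ lookup w k ∣ → j ≡ k
  injF j k eq = FP.toℕ-injective (injective _ _ (FP.toℕ<n j) (FP.toℕ<n k)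
    (trans (sym (cong ∣_∣ (lookup≡act w j))) (trans eq (cong ∣_∣ (lookup≡act w k)))))

-- InD[ K ] v says v ∈ D_{K+1}: v is in D_n and fixes K+2, …, n.
record InD[_] {n} (K : ℕ) (v : SP n) : Set where
  constructor _fixing_
  field
    inD   : InD′ v
    fixes : ∀ m → K < m → m < n → act v (+ suc m) ≡ + suc m

InD[]-suc : ∀ {n K} {v : SP n} → InD[ K ] v → InD[ suc K ] v
InD[]-suc {K = K} (d fixing fixes) = d fixing λ m K<m → fixes m (ℕP.<-trans (ℕP.n<1+n K) K<m)

act-cancel : ∀ {n} {w : SP n} → InD′ w →
  ∀ {y y'} → y ∈± n → y' ∈± n → act w y ≡ act w y' → y ≡ y'
act-cancel (inD′ _ inj _) (pos {m} p) (pos {m'} p') e = cong (+_ ∘ suc) (inj m m' p p' (cong ∣_∣ e))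
act-cancel {w = w} (inD′ _ inj _) (neg {m} p) (neg {m'} p') e = cong -[1+_] (inj m m' p p'
  (trans (sym (ℤP.∣-i∣≡∣i∣ (act w (+ suc m))))
         (trans (cong ∣_∣ e) (ℤP.∣-i∣≡∣i∣ (act w (+ suc m'))))))
act-cancel {w = w} (inD′ range inj _) (pos {m} p) (neg {m'} p') e =
  ⊥-elim (∈±-self-neg (range m p) (trans e (cong (λ k → ℤ.- act w (+ suc k)) (sym m≡m'))))
  where
  m≡m' : m ≡ m'
  m≡m' = inj m m' p p' (trans (cong ∣_∣ e) (ℤP.∣-i∣≡∣i∣ (act w (+ suc m'))))
act-cancel d (neg p) (pos p') e = sym (act-cancel d (pos p') (neg p) (sym e))

InD[]-idₛ : ∀ {n} K → InD[ K ] (idₛ {n})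
InD[]-idₛ {n} K = inD′ range injective even fixing λ m _ → act-idₛ m
  where
  range : ∀ m → m < n → act (idₛ {n}) (+ suc m) ∈± n
  range m m<n = subst (_∈± n) (sym (act-idₛ m m<n)) (pos m<n)
  injective : ∀ m m' → m < n → m' < n →
    ∣ act (idₛ {n}) (+ suc m) ∣ ≡ ∣ act (idₛ {n}) (+ suc m') ∣ → m ≡ m'
  injective m m' p p' eq =
    ℕP.suc-injective (trans (sym (cong ∣_∣ (act-idₛ m p))) (trans eq (cong ∣_∣ (act-idₛ m' p'))))
  even : negatives (idₛ {n}) % 2 ≡ 0
  even = cong (_% 2) (trans (sum<-cong n _ _ λ m p → cong negBit (act-idₛ m p)) (sum<-zero n))

-- D_1 is trivial: w(1) = ±1 by injectivity, and the sign is + by parity.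
InD[0]⇒idₛ : ∀ {n} (w : SP (suc n)) → InD[ 0 ] w → w ≡ idₛ
InD[0]⇒idₛ {n} w (inD′ range inj even fixing fixes) = SP-ext _ _ λ where
    zero 0<n → trans w1≡1 (sym (act-idₛ 0 0<n))
    (suc m) m<n → trans (fixes (suc m) (s≤s z≤n) m<n) (sym (act-idₛ (suc m) m<n))
  where
  rest : sum< n (λ m → negBit (act w (+ suc (suc m)))) ≡ 0
  rest = trans (sum<-cong n _ _ λ m p → cong negBit (fixes (suc m) (s≤s z≤n) (s≤s p))) (sum<-zero n)
  w1≡1 : act w (+ 1) ≡ + 1
  w1≡1 with ∈±-abs (range 0 (s≤s z≤n))
  ... | suc j , j<n , eq
    with inj 0 (suc j) (s≤s z≤n) j<n (trans eq (cong ∣_∣ (sym (fixes (suc j) (s≤s z≤n) j<n))))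
  ...   | ()
  w1≡1 | zero , _ , eq with ∈±-sign (range 0 (s≤s z≤n)) eq
  ...   | inj₁ w1≡1 = w1≡1
  ...   | inj₂ w1≡-1 with trans (cong (λ x → (negBit x + 0) % 2) (sym w1≡-1))
                          (trans (cong (λ r → (negBit (act w (+ 1)) + r) % 2) (sym rest)) even)
  ...     | ()

RightStable : ∀ {n} → ℕ → SP n → Set
RightStable {n} K r = ∀ (v : SP n) → InD[ K ] v → InD[ K ] (v ∘ₛ r)

rightStable-idₛ : ∀ {n} K → RightStable {n} K idₛ
rightStable-idₛ K v d = subst InD[ K ] (sym (∘ₛ-identityʳ v)) d

rightStable-∘ₛ : ∀ {n} K (a b : SP n) → RightStable K a → RightStable K b → RightStable K (a ∘ₛ b)
rightStable-∘ₛ K a b stable-a stable-b v d = subst InD[ K ] (∘ₛ-assoc v a b) (stable-b _ (stable-a v d))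

InD′-reindex : ∀ {n} {v v' : SP n} a → suc a < n →
  (∀ m → m < n → ∣ act v' (+ suc m) ∣ ≡ ∣ act v (+ suc (swap a m)) ∣) →
  negatives v' % 2 ≡ negatives v % 2 → InD′ v → InD′ v'
InD′-reindex {n} {v} {v'} a a<n abs-eq parity (inD′ range inj even) = inD′ range' inj' (trans parity even)
  where
  range' : ∀ m → m < n → act v' (+ suc m) ∈± n
  range' m m<n = ∈±-cong-abs (abs-eq m m<n) (range _ (swap-< a m a<n m<n))
  inj' : ∀ m m' → m < n → m' < n → ∣ act v' (+ suc m) ∣ ≡ ∣ act v' (+ suc m') ∣ → m ≡ m'
  inj' m m' p p' eq = begin
    m                  ≡⟨ swap-involutive a m ⟨
    swap a (swap a m)  ≡⟨ cong (swap a) (inj _ _ (swap-< a m a<n p) (swap-< a m' a<n p')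
                            (trans (sym (abs-eq m p)) (trans eq (abs-eq m' p')))) ⟩
    swap a (swap a m') ≡⟨ swap-involutive a m' ⟩
    m'                 ∎
    where open ≡-Reasoning

rightStable-s : ∀ {n} K a → suc a ≤ K → K < n → RightStable {n} K (s (suc a))
rightStable-s {n} K a a<K K<n v (d fixing fixes) =
  InD′-reindex a a<n (λ m m<n → cong ∣_∣ (reindexed m m<n)) parity d fixing fixes'
  where
  a<n : suc a < n
  a<n = ℕP.≤-<-trans a<K K<n
  reindexed : ∀ m → m < n → act (v ∘ₛ s (suc a)) (+ suc m) ≡ act v (+ suc (swap a m))
  reindexed m m<n = trans (act-∘ₛ v (s (suc a)) (+ suc m)) (cong (act v) (act-s a m m<n))
  parity : negatives (v ∘ₛ s (suc a)) % 2 ≡ negatives v % 2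
  parity = cong (_% 2)
    (trans (sum<-cong n _ _ λ m m<n → cong negBit (reindexed m m<n)) (sum<-swap n a _ a<n))
  fixes' : ∀ m → K < m → m < n → act (v ∘ₛ s (suc a)) (+ suc m) ≡ + suc m
  fixes' m K<m m<n = trans (reindexed m m<n)
    (trans (cong (act v ∘ +_ ∘ suc) (swap-fixes a m (ℕP.≤-<-trans a<K K<m))) (fixes m K<m m<n))

injective-hits-top : ∀ L (f : ℕ → ℕ) →
  (∀ i → i < suc L → ∃[ j ] j < suc L × f i ≡ suc j) →
  (∀ i i' → i < suc L → i' < suc L → f i ≡ f i' → i ≡ i') →
  ∃[ i ] i < suc L × f i ≡ suc L
injective-hits-top L f bounded inj with FP.any? {n = suc L} (λ i → f (toℕ i) ℕP.≟ suc L)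
... | yes (i , fi≡) = toℕ i , FP.toℕ<n i , fi≡
... | no ¬hit = ⊥-elim (ℕP.<-irrefl refl (FP.injective⇒≤ g-injective))
  where
  below : ∀ (i : Fin (suc L)) → ∃[ j ] j < L × f (toℕ i) ≡ suc j
  below i with bounded (toℕ i) (FP.toℕ<n i)
  ... | j , j<1+L , fi≡ =
    j , ℕP.≤∧≢⇒< (ℕP.≤-pred j<1+L) (λ j≡L → ¬hit (i , trans fi≡ (cong suc j≡L))) , fi≡
  g : Fin (suc L) → Fin L
  g i = fromℕ< (proj₁ (proj₂ (below i)))
  g-injective : Injective _≡_ _≡_ g
  g-injective {i} {i'} gi≡gi' = FP.toℕ-injective (inj _ _ (FP.toℕ<n i) (FP.toℕ<n i')
    (trans (proj₂ (proj₂ (below i))) (trans (cong suc j≡j') (sym (proj₂ (proj₂ (below i')))))))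
    where
    j≡j' : proj₁ (below i) ≡ proj₁ (below i')
    j≡j' = trans (sym (FP.toℕ-fromℕ< _)) (trans (cong toℕ gi≡gi') (FP.toℕ-fromℕ< _))

preimage-top : ∀ {n L} {w : SP n} → L < n → InD[ L ] w → ∃[ y ] y ∈± suc L × act w y ≡ + suc L
preimage-top {n} {L} {w} L<n (inD′ range inj _ fixing fixes) =
  signed (injective-hits-top L (λ i → ∣ act w (+ suc i) ∣) bounded
    (λ i i' p p' → inj i i' (lt p) (lt p')))
  where
  lt : ∀ {i} → i < suc L → i < n
  lt p = ℕP.<-≤-trans p L<n
  bounded : ∀ i → i < suc L → ∃[ j ] j < suc L × ∣ act w (+ suc i) ∣ ≡ suc j
  bounded i p with ∈±-abs (range i (lt p))
  ... | j , j<n , eq with j ℕP.≤? L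
  ...   | yes j≤L = j , s≤s j≤L , eq
  ...   | no j≰L = ⊥-elim (ℕP.<⇒≱ L<j (subst (_≤ L) i≡j (ℕP.≤-pred p)))
    where
    L<j = ℕP.≰⇒> j≰L
    i≡j = inj i j (lt p) j<n (trans eq (cong ∣_∣ (sym (fixes j L<j j<n))))
  signed : (∃[ i ] i < suc L × ∣ act w (+ suc i) ∣ ≡ suc L) →
    ∃[ y ] y ∈± suc L × act w y ≡ + suc L
  signed (i , p , eq) with ∈±-sign (range i (lt p)) eq
  ... | inj₁ wi≡ = + suc i , pos p , wi≡
  ... | inj₂ wi≡ = -[1+ i ] , neg p , cong ℤ.-_ wi≡

rightStable-down : ∀ {n} K → K < n → ∀ j → j ≤ K → RightStable K (down {n} j)
rightStable-down K K<n zero _ = rightStable-idₛ K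
rightStable-down K K<n (suc j) j<K =
  rightStable-∘ₛ K _ (down j) (rightStable-s K j j<K K<n) (rightStable-down K K<n j (ℕP.<⇒≤ j<K))

rightStable-up : ∀ {n} K → K < n → ∀ j → j ≤ K → RightStable K (up {n} j)
rightStable-up K K<n zero _ = rightStable-idₛ K
rightStable-up K K<n (suc zero) _ = rightStable-idₛ K
rightStable-up K K<n (suc (suc j)) j<K =
  rightStable-∘ₛ K (up (suc j)) _
    (rightStable-up K K<n (suc j) (ℕP.<⇒≤ j<K)) (rightStable-s K (suc j) j<K K<n)

Inverses : ∀ {n} → SP n → SP n → Set
Inverses {n} r r' = ∀ y → y ∈± n → act r (act r' y) ≡ y × act r' (act r y) ≡ y

Inverses-sym : ∀ {n} {r r' : SP n} → Inverses r r' → Inverses r' r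
Inverses-sym inv y y∈ = proj₂ (inv y y∈) , proj₁ (inv y y∈)

Inverses-∘ₛ : ∀ {n} {a a' b b' : SP n} →
  (∀ y → y ∈± n → act a' y ∈± n) → (∀ y → y ∈± n → act b y ∈± n) →
  Inverses a a' → Inverses b b' → Inverses (a ∘ₛ b) (b' ∘ₛ a')
Inverses-∘ₛ {a = a} {a'} {b} {b'} maps-a' maps-b inv-a inv-b y y∈ =
    trans (act-∘ₛ a b (act (b' ∘ₛ a') y)) (trans (cong (act a ∘ act b) (act-∘ₛ b' a' y))
      (trans (cong (act a) (proj₁ (inv-b _ (maps-a' y y∈)))) (proj₁ (inv-a y y∈))))
  , trans (act-∘ₛ b' a' (act (a ∘ₛ b) y)) (trans (cong (act b' ∘ act a') (act-∘ₛ a b y))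
      (trans (cong (act b') (proj₂ (inv-a _ (maps-b y y∈)))) (proj₂ (inv-b y y∈))))

∘ₛ-cancelʳ : ∀ {n} {r r' : SP n} → Inverses r r' → ∀ u → (u ∘ₛ r) ∘ₛ r' ≡ u
∘ₛ-cancelʳ {r = r} {r'} inv u = SP-ext _ _ λ m m<n →
  trans (act-∘ₛ₃ u r r' (+ suc m)) (cong (act u) (proj₁ (inv (+ suc m) (pos m<n))))

∑ : ∀ {A : Set} → List A → (A → ℕ) → ℕ
∑ [] f = 0
∑ (x ∷ xs) f = f x + ∑ xs f

syntax ∑ xs (λ x → e) = ∑[ x ← xs ] e

∑-++ : ∀ {A : Set} (xs ys : List A) f → ∑ (xs ++ ys) f ≡ ∑ xs f + ∑ ys f
∑-++ [] ys f = refl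
∑-++ (x ∷ xs) ys f = trans (cong (_+_ (f x)) (∑-++ xs ys f)) (sym (ℕP.+-assoc (f x) _ _))

∑-map : ∀ {A B : Set} (g : A → B) (xs : List A) f → ∑ (L.map g xs) f ≡ ∑ xs (f ∘ g)
∑-map g [] f = refl
∑-map g (x ∷ xs) f = cong (_+_ (f (g x))) (∑-map g xs f)

∑-concatMap : ∀ {A B : Set} (h : A → List B) (xs : List A) f →
  ∑ (concatMap h xs) f ≡ ∑[ x ← xs ] ∑ (h x) f
∑-concatMap h [] f = refl
∑-concatMap h (x ∷ xs) f =
  trans (∑-++ (h x) (concatMap h xs) f) (cong (_+_ (∑ (h x) f)) (∑-concatMap h xs f))

∑-zero : ∀ {A : Set} (xs : List A) → ∑[ x ← xs ] 0 ≡ 0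
∑-zero [] = refl
∑-zero (x ∷ xs) = ∑-zero xs

∑-+ : ∀ {A : Set} (xs : List A) f g → ∑ xs f + ∑ xs g ≡ ∑[ x ← xs ] (f x + g x)
∑-+ [] f g = refl
∑-+ (x ∷ xs) f g =
  trans (interchange (f x) (∑ xs f) (g x) (∑ xs g)) (cong (_+_ (f x + g x)) (∑-+ xs f g))

∑-comm : ∀ {A B : Set} (xs : List A) (ys : List B) (F : A → B → ℕ) →
  ∑[ x ← xs ] ∑[ y ← ys ] F x y ≡ ∑[ y ← ys ] ∑[ x ← xs ] F x y
∑-comm [] ys F = sym (∑-zero ys)
∑-comm (x ∷ xs) ys F = trans (cong (_+_ (∑ ys (F x))) (∑-comm xs ys F)) (∑-+ ys (F x) _)

∑-cong : ∀ {A : Set} (xs : List A) {f g : A → ℕ} → (∀ x → f x ≡ g x) → ∑ xs f ≡ ∑ xs g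
∑-cong [] eq = refl
∑-cong (x ∷ xs) eq = cong₂ _+_ (eq x) (∑-cong xs eq)

∑-cong-All : ∀ {A : Set} {P : A → Set} {xs : List A} {f g : A → ℕ} →
  All P xs → (∀ {x} → P x → f x ≡ g x) → ∑ xs f ≡ ∑ xs g
∑-cong-All [] eq = refl
∑-cong-All (px ∷ pxs) eq = cong₂ _+_ (eq px) (∑-cong-All pxs eq)

indicator : ∀ {P : Set} → Dec P → ℕ
indicator d = if does d then 1 else 0

indicator-yes : ∀ {P : Set} → P → (d : Dec P) → indicator d ≡ 1
indicator-yes p (yes _) = refl
indicator-yes p (no ¬p) = ⊥-elim (¬p p)

indicator-no : ∀ {P : Set} → ¬ P → (d : Dec P) → indicator d ≡ 0
indicator-no ¬p (yes p) = ⊥-elim (¬p p)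
indicator-no ¬p (no _) = refl

indicator-⇔ : ∀ {P Q : Set} → (P → Q) → (Q → P) →
  (dp : Dec P) (dq : Dec Q) → indicator dp ≡ indicator dq
indicator-⇔ to from (yes p) dq = sym (indicator-yes (to p) dq)
indicator-⇔ to from (no ¬p) dq = sym (indicator-no (¬p ∘ from) dq)

infix 4 _≟ₛ_
_≟ₛ_ : ∀ {n} (u v : SP n) → Dec (u ≡ v)
_≟ₛ_ = ≡-dec ℤ._≟_

multiplicity : ∀ {n} → SP n → List (SP n) → ℕ
multiplicity w xs = ∑[ v ← xs ] indicator (v ≟ₛ w)

multiplicity-concatMap : ∀ {n} (w : SP n) (xs : List (SP n)) {R : List (SP n × SP n)} →
  All (uncurry Inverses) R →
  multiplicity w (concatMap (λ u → L.map (u ∘ₛ_) (L.map proj₁ R)) xs) ≡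
  ∑[ p ← R ] multiplicity (w ∘ₛ proj₂ p) xs
multiplicity-concatMap w xs {R} inverses = begin
  multiplicity w (concatMap (λ u → L.map (u ∘ₛ_) (L.map proj₁ R)) xs)
    ≡⟨ ∑-concatMap _ xs _ ⟩
  ∑[ u ← xs ] multiplicity w (L.map (u ∘ₛ_) (L.map proj₁ R))
    ≡⟨ ∑-cong xs (λ u → trans (∑-map (u ∘ₛ_) (L.map proj₁ R) _) (∑-map proj₁ R _)) ⟩
  ∑[ u ← xs ] ∑[ p ← R ] indicator (u ∘ₛ proj₁ p ≟ₛ w)
    ≡⟨ ∑-comm xs R _ ⟩
  ∑[ p ← R ] ∑[ u ← xs ] indicator (u ∘ₛ proj₁ p ≟ₛ w)
    ≡⟨ ∑-cong-All inverses (λ {p} inv → ∑-cong xs λ u →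
         indicator-⇔ (shift inv u) (unshift inv u) (u ∘ₛ proj₁ p ≟ₛ w) (u ≟ₛ w ∘ₛ proj₂ p)) ⟩
  ∑[ p ← R ] multiplicity (w ∘ₛ proj₂ p) xs
    ∎
  where
  open ≡-Reasoning
  shift : ∀ {r r'} → Inverses r r' → ∀ u → u ∘ₛ r ≡ w → u ≡ w ∘ₛ r'
  shift inv u refl = sym (∘ₛ-cancelʳ inv u)
  unshift : ∀ {r r'} → Inverses r r' → ∀ u → u ≡ w ∘ₛ r' → u ∘ₛ r ≡ w
  unshift inv u refl = ∘ₛ-cancelʳ (Inverses-sym inv) w

ones : ∀ {n} → List (SP n) → ZG n
ones = L.map (+ 1 ,_)

coeff-ones : ∀ {n} (xs : List (SP n)) w → coeff (ones xs) w ≡ + multiplicity w xs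
coeff-ones [] w = refl
coeff-ones (x ∷ xs) w with ≡-dec ℤ._≟_ x w
... | yes _ = cong (ℤ._+_ (+ 1)) (coeff-ones xs w)
... | no _ = coeff-ones xs w

map-∘-cong : ∀ {A B C D : Set} {f : B → D} {g : A → B} {h : C → D} {k : A → C} →
  (∀ x → f (g x) ≡ h (k x)) → ∀ xs → L.map f (L.map g xs) ≡ L.map h (L.map k xs)
map-∘-cong eq [] = refl
map-∘-cong eq (x ∷ xs) = cong₂ _∷_ (eq x) (map-∘-cong eq xs)

ones-*ᴳ : ∀ {n} (xs ys : List (SP n)) →
  ones xs *ᴳ ones ys ≡ ones (concatMap (λ u → L.map (u ∘ₛ_) ys) xs)
ones-*ᴳ [] ys = refl
ones-*ᴳ (x ∷ xs) ys = trans (cong₂ _++_ (map-∘-cong (λ _ → refl) ys) (ones-*ᴳ xs ys))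
  (sym (LP.map-++ (+ 1 ,_) (L.map (x ∘ₛ_) ys) _))

negBit-neg₂ : ∀ {x y n} R → x ∈± n → y ∈± n →
  (negBit (ℤ.- y) + (negBit (ℤ.- x) + R)) % 2 ≡ (negBit x + (negBit y + R)) % 2
negBit-neg₂ R (pos _) (pos _) = trans (cong (_% 2) (ℕP.+-comm 2 R)) ([m+n]%n≡m%n R 2)
negBit-neg₂ R (pos _) (neg _) = refl
negBit-neg₂ R (neg _) (pos _) = refl
negBit-neg₂ R (neg _) (neg _) = sym (trans (cong (_% 2) (ℕP.+-comm 2 R)) ([m+n]%n≡m%n R 2))

module Rank (n′ : ℕ) where

  N : ℕ
  N = suc (suc n′)

  s̄ : SP N
  s̄ = s̄₁

  s̄-fixes : ∀ m → suc (suc m) < N → act s̄ (+ suc (suc (suc m))) ≡ + suc (suc (suc m))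
  s̄-fixes m p = trans (act-tabulate (entry ∘ toℕ) (suc (suc m)) p) (cong entry (FP.toℕ-fromℕ< p))
    where
    entry : ℕ → ℤ
    entry k = if k ≡ᵇ 0 then -[1+ 1 ] else if k ≡ᵇ 1 then -[1+ 0 ] else + suc k

  s̄-∈± : ∀ y → y ∈± N → act s̄ y ∈± N
  s̄-∈± = act-∈± s̄ λ where
    zero _ → neg (s≤s (s≤s z≤n))
    (suc zero) _ → neg (s≤s z≤n)
    (suc (suc m)) p → subst (_∈± N) (sym (s̄-fixes m p)) (pos p)

  s̄-involutive : ∀ y → y ∈± N → act s̄ (act s̄ y) ≡ y
  s̄-involutive = act-inverse-∈± s̄ s̄ λ where
    zero _ → refl
    (suc zero) _ → refl
    (suc (suc m)) p → trans (cong (act s̄) (s̄-fixes m p)) (s̄-fixes m p)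

  -- Right multiplication by s̄ swaps the first two entries and negates both.
  rightStable-s̄ : ∀ K → 1 ≤ K → K < N → RightStable K s̄
  rightStable-s̄ K 1≤K K<N v (d fixing fixes) =
    InD′-reindex 0 (s≤s (s≤s z≤n)) abs-eq parity d fixing fixes'
    where
    open InD′ d using (range)
    act-high : ∀ m → suc (suc m) < N →
      act (v ∘ₛ s̄) (+ suc (suc (suc m))) ≡ act v (+ suc (suc (suc m)))
    act-high m p = trans (act-∘ₛ v s̄ (+ suc (suc (suc m)))) (cong (act v) (s̄-fixes m p))
    abs-eq : ∀ m → m < N → ∣ act (v ∘ₛ s̄) (+ suc m) ∣ ≡ ∣ act v (+ suc (swap 0 m)) ∣
    abs-eq zero _ = ℤP.∣-i∣≡∣i∣ (act v (+ 2))
    abs-eq (suc zero) _ = ℤP.∣-i∣≡∣i∣ (act v (+ 1))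
    abs-eq (suc (suc m)) p = cong ∣_∣ (act-high m p)
    parity : negatives (v ∘ₛ s̄) % 2 ≡ negatives v % 2
    parity = trans
      (cong (λ R → (negBit (ℤ.- act v (+ 2)) + (negBit (ℤ.- act v (+ 1)) + R)) % 2)
            (sum<-cong n′ _ _ λ m p → cong negBit (act-high m (s≤s (s≤s p)))))
      (negBit-neg₂ _ (range 0 (s≤s z≤n)) (range 1 (s≤s (s≤s z≤n))))
    fixes' : ∀ m → K < m → m < N → act (v ∘ₛ s̄) (+ suc m) ≡ + suc m
    fixes' (suc (suc m)) K<m p = trans (act-high m p) (fixes _ K<m p)
    fixes' (suc zero) (s≤s K≤0) _ with ℕP.≤-trans 1≤K K≤0
    ... | ()

  t : ℕ → SP N
  t L = (down L ∘ₛ s̄) ∘ₛ up L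

  t-suc : ∀ j y →
    act (t (suc (suc j))) y ≡ act (s (suc (suc j))) (act (t (suc j)) (act (s (suc (suc j))) y))
  t-suc j y = begin
      act (t (suc (suc j))) y
    ≡⟨ act-∘ₛ₃ (σ ∘ₛ d) s̄ (u ∘ₛ σ) y ⟩
      act (σ ∘ₛ d) (act s̄ (act (u ∘ₛ σ) y))
    ≡⟨ act-∘ₛ σ d (act s̄ (act (u ∘ₛ σ) y)) ⟩
      act σ (act d (act s̄ (act (u ∘ₛ σ) y)))
    ≡⟨ cong (act σ ∘ act d ∘ act s̄) (act-∘ₛ u σ y) ⟩
      act σ (act d (act s̄ (act u (act σ y))))
    ≡⟨ cong (act σ) (act-∘ₛ₃ d s̄ u (act σ y)) ⟨
      act σ (act (t (suc j)) (act σ y))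
    ∎
    where
    open ≡-Reasoning
    σ = s {N} (suc (suc j))
    d = down {N} (suc j)
    u = up {N} (suc j)

  t-one : ∀ {y} → y ∈± N → act (t 1) y ≡ act (s 1) (act s̄ y)
  t-one {y} y∈ = begin
    act (t 1) y                           ≡⟨ act-∘ₛ₃ (s 1 ∘ₛ idₛ) s̄ idₛ y ⟩
    act (s 1 ∘ₛ idₛ) (act s̄ (act idₛ y))  ≡⟨ cong (act (s 1 ∘ₛ idₛ) ∘ act s̄) (act-idₛ-∈± y∈) ⟩
    act (s 1 ∘ₛ idₛ) (act s̄ y)            ≡⟨ act-∘ₛ (s 1) idₛ (act s̄ y) ⟩
    act (s 1) (act idₛ (act s̄ y))         ≡⟨ cong (act (s 1)) (act-idₛ-∈± (s̄-∈± y y∈)) ⟩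
    act (s 1) (act s̄ y)                   ∎
    where open ≡-Reasoning

  t-one-fixes : ∀ m → suc (suc m) < N → act (t 1) (+ suc (suc (suc m))) ≡ + suc (suc (suc m))
  t-one-fixes m p = trans (t-one (pos p))
    (trans (cong (act (s 1)) (s̄-fixes m p)) (s-fixes 0 (suc (suc m)) (s≤s (s≤s z≤n)) p))

  t-∈± : ∀ j → suc j < N → ∀ y → y ∈± N → act (t (suc j)) y ∈± N
  t-∈± zero p y y∈ = subst (_∈± N) (sym (t-one y∈)) (s-∈± 0 p _ (s̄-∈± y y∈))
  t-∈± (suc j) p y y∈ = subst (_∈± N) (sym (t-suc j y))
    (s-∈± (suc j) p _ (t-∈± j (ℕP.<⇒≤ p) _ (s-∈± (suc j) p y y∈)))

  t-involutive : ∀ j → suc j < N → ∀ y → y ∈± N → act (t (suc j)) (act (t (suc j)) y) ≡ y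
  t-involutive zero p = act-inverse-∈± (t 1) (t 1) λ where   -- t 1 negates 1 and 2
    zero q → trans (cong (act (t 1)) (t-one (pos q))) (cong ℤ.-_ (t-one (pos q)))
    (suc zero) q → trans (cong (act (t 1)) (t-one (pos q))) (cong ℤ.-_ (t-one (pos q)))
    (suc (suc m)) q → trans (cong (act (t 1)) (t-one-fixes m q)) (t-one-fixes m q)
  t-involutive (suc j) p y y∈ = begin
      act t′ (act t′ y)
    ≡⟨ t-suc j (act t′ y) ⟩
      act σ (act tⱼ (act σ (act t′ y)))
    ≡⟨ cong (act σ ∘ act tⱼ ∘ act σ) (t-suc j y) ⟩
      act σ (act tⱼ (act σ (act σ (act tⱼ (act σ y)))))
    ≡⟨ cong (act σ ∘ act tⱼ) (s-involutive (suc j) p _ (t-∈± j j<N _ σy∈)) ⟩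
      act σ (act tⱼ (act tⱼ (act σ y)))
    ≡⟨ cong (act σ) (t-involutive j j<N _ σy∈) ⟩
      act σ (act σ y)
    ≡⟨ s-involutive (suc j) p y y∈ ⟩
      y
    ∎
    where
    open ≡-Reasoning
    σ = s {N} (suc (suc j))
    tⱼ = t (suc j)
    t′ = t (suc (suc j))
    j<N = ℕP.<⇒≤ p
    σy∈ = s-∈± (suc j) p y y∈

  t-top : ∀ j → suc j < N → act (t (suc j)) (+ suc (suc j)) ≡ -[1+ suc j ]
  t-top zero p = t-one (pos p)
  t-top (suc j) p = begin
      act (t (suc (suc j))) (+ suc (suc (suc j)))
    ≡⟨ t-suc j (+ suc (suc (suc j))) ⟩
      act σ (act (t (suc j)) (act σ (+ suc (suc (suc j)))))
    ≡⟨ cong (act σ ∘ act (t (suc j)))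
            (trans (act-s (suc j) (suc (suc j)) p) (cong (+_ ∘ suc) (swap-right (suc j)))) ⟩
      act σ (act (t (suc j)) (+ suc (suc j)))
    ≡⟨ cong (act σ) (t-top j (ℕP.<⇒≤ p)) ⟩
      act σ -[1+ suc j ]
    ≡⟨ cong ℤ.-_ (trans (act-s (suc j) (suc j) (ℕP.<⇒≤ p)) (cong (+_ ∘ suc) (swap-left (suc j)))) ⟩
      -[1+ suc (suc j) ]
    ∎
    where
    open ≡-Reasoning
    σ = s {N} (suc (suc j))

  rightStable-t : ∀ K L → 1 ≤ K → K < N → L ≤ K → RightStable K (t L)
  rightStable-t K L 1≤K K<N L≤K = rightStable-∘ₛ K (down L ∘ₛ s̄) (up L)
    (rightStable-∘ₛ K (down L) s̄ (rightStable-down K K<N L L≤K) (rightStable-s̄ K 1≤K K<N))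
    (rightStable-up K K<N L L≤K)

  record InversePair (L : ℕ) (r r' : SP N) : Set where
    field
      maps     : ∀ y → y ∈± N → act r y ∈± N
      maps'    : ∀ y → y ∈± N → act r' y ∈± N
      inverses : Inverses r r'
      stable   : ∀ K → L ≤ K → K < N → RightStable K r × RightStable K r'
  open InversePair

  InversePair-involution : ∀ {L r} →
    (∀ y → y ∈± N → act r y ∈± N) → (∀ y → y ∈± N → act r (act r y) ≡ y) →
    (∀ K → L ≤ K → K < N → RightStable K r) → InversePair L r r
  InversePair-involution maps-r involutive stable-r = record
    { maps = maps-r ; maps' = maps-r
    ; inverses = λ y y∈ → involutive y y∈ , involutive y y∈
    ; stable = λ K L≤K K<N → stable-r K L≤K K<N , stable-r K L≤K K<N }

  InversePair-suc : ∀ {L r r'} → InversePair L r r' → InversePair (suc L) r r'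
  InversePair-suc ip = record
    { maps = maps ip ; maps' = maps' ip ; inverses = inverses ip
    ; stable = λ K L<K → stable ip K (ℕP.<⇒≤ L<K) }

  InversePair-∘ₛ : ∀ {L a a' b b'} → InversePair L a a' → InversePair L b b' →
    InversePair L (a ∘ₛ b) (b' ∘ₛ a')
  InversePair-∘ₛ {a = a} {a'} {b} {b'} ia ib = record
    { maps = λ y y∈ → subst (_∈± N) (sym (act-∘ₛ a b y)) (maps ia _ (maps ib y y∈))
    ; maps' = λ y y∈ → subst (_∈± N) (sym (act-∘ₛ b' a' y)) (maps' ib _ (maps' ia y y∈))
    ; inverses = Inverses-∘ₛ (maps' ia) (maps ib) (inverses ia) (inverses ib)
    ; stable = λ K L≤K K<N →
        rightStable-∘ₛ K a b (proj₁ (stable ia K L≤K K<N)) (proj₁ (stable ib K L≤K K<N)) ,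
        rightStable-∘ₛ K b' a' (proj₂ (stable ib K L≤K K<N)) (proj₂ (stable ia K L≤K K<N)) }

  InversePair-idₛ : ∀ L → InversePair L idₛ idₛ
  InversePair-idₛ L = InversePair-involution
    (λ y y∈ → subst (_∈± N) (sym (act-idₛ-∈± y∈)) y∈)
    (λ y y∈ → trans (cong (act idₛ) (act-idₛ-∈± y∈)) (act-idₛ-∈± y∈))
    (λ K _ _ → rightStable-idₛ K)

  InversePair-s : ∀ a → suc a < N → InversePair (suc a) (s (suc a)) (s (suc a))
  InversePair-s a p =
    InversePair-involution (s-∈± a p) (s-involutive a p) (λ K a<K K<N → rightStable-s K a a<K K<N)

  InversePair-s̄ : InversePair 1 s̄ s̄
  InversePair-s̄ = InversePair-involution s̄-∈± s̄-involutive rightStable-s̄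

  InversePair-t : ∀ j → suc j < N → InversePair (suc j) (t (suc j)) (t (suc j))
  InversePair-t j p = InversePair-involution (t-∈± j p) (t-involutive j p)
    (λ K j<K K<N → rightStable-t K (suc j) (ℕP.≤-trans (s≤s z≤n) j<K) K<N j<K)

  mul-s : ℕ → SP N × SP N → SP N × SP N
  mul-s i (r , r') = s i ∘ₛ r , r' ∘ₛ s i

  -- reps k lists the terms of Ψ_{k+1}, each paired with its inverse.
  reps : ℕ → List (SP N × SP N)
  reps zero = (idₛ , idₛ) ∷ (s 1 , s 1) ∷ (s̄ , s̄) ∷ (s 1 ∘ₛ s̄ , s̄ ∘ₛ s 1) ∷ []
  reps (suc k) =
    (idₛ , idₛ) ∷ (L.map (mul-s (suc (suc k))) (reps k) ++ (t (suc (suc k)) , t (suc (suc k))) ∷ [])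

  reps-inverse : ∀ k → suc k < N → All (uncurry (InversePair (suc k))) (reps k)
  reps-inverse zero p =
    InversePair-idₛ 1 ∷ InversePair-s 0 p ∷ InversePair-s̄ ∷
    InversePair-∘ₛ (InversePair-s 0 p) InversePair-s̄ ∷ []
  reps-inverse (suc k) p = InversePair-idₛ _ ∷ AllP.++⁺
    (AllP.map⁺ (All.map (InversePair-∘ₛ (InversePair-s (suc k) p) ∘ InversePair-suc)
                        (reps-inverse k (ℕP.<⇒≤ p))))
    (InversePair-t (suc k) p ∷ [])

  Ψ≡reps : ∀ k → Ψ {N} (suc k) ≡ ones (L.map proj₁ (reps k))
  Ψ≡reps zero = refl
  Ψ≡reps (suc k) = cong ((+ 1 , idₛ) ∷_) (begin
    (L.map (λ { (b , v) → (+ 1 ℤ.* b , σ ∘ₛ v) }) (Ψ (suc k)) ++ []) ++ tₖ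
      ≡⟨ cong (_++ tₖ) (LP.++-identityʳ _) ⟩
    L.map (λ { (b , v) → (+ 1 ℤ.* b , σ ∘ₛ v) }) (Ψ (suc k)) ++ tₖ
      ≡⟨ cong (λ z → L.map (λ { (b , v) → (+ 1 ℤ.* b , σ ∘ₛ v) }) z ++ tₖ) (Ψ≡reps k) ⟩
    L.map (λ { (b , v) → (+ 1 ℤ.* b , σ ∘ₛ v) }) (ones (L.map proj₁ (reps k))) ++ tₖ
      ≡⟨ cong (_++ tₖ) (map-∘-cong (λ _ → refl) (L.map proj₁ (reps k))) ⟩
    ones (L.map (σ ∘ₛ_) (L.map proj₁ (reps k))) ++ tₖ
      ≡⟨ cong (λ z → ones z ++ tₖ) (map-∘-cong (λ _ → refl) (reps k)) ⟩
    ones (L.map proj₁ (L.map (mul-s (suc (suc k))) (reps k))) ++ tₖ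
      ≡⟨ LP.map-++ (+ 1 ,_) (L.map proj₁ (L.map (mul-s (suc (suc k))) (reps k))) _ ⟨
    ones (L.map proj₁ (L.map (mul-s (suc (suc k))) (reps k)) ++ t (suc (suc k)) ∷ [])
      ≡⟨ cong ones (LP.map-++ proj₁ (L.map (mul-s (suc (suc k))) (reps k)) _) ⟨
    ones (L.map proj₁ (L.map (mul-s (suc (suc k))) (reps k) ++ (t (suc (suc k)) , t (suc (suc k))) ∷ []))
      ∎)
    where
    open ≡-Reasoning
    σ = s {N} (suc (suc k))
    tₖ = (+ 1 , t (suc (suc k))) ∷ []

  terms : ℕ → List (SP N)
  terms zero = idₛ ∷ []
  terms (suc k) = concatMap (λ u → L.map (u ∘ₛ_) (L.map proj₁ (reps k))) (terms k)

  prodΨ≡terms : ∀ k → prodΨ {N} k ≡ ones (terms k)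
  prodΨ≡terms zero = refl
  prodΨ≡terms (suc k) rewrite prodΨ≡terms k | Ψ≡reps k = ones-*ᴳ (terms k) (L.map proj₁ (reps k))

  multiplicity-step : ∀ k → suc k < N → ∀ w →
    multiplicity w (terms (suc k)) ≡ ∑[ p ← reps k ] multiplicity (w ∘ₛ proj₂ p) (terms k)
  multiplicity-step k p w = multiplicity-concatMap w (terms k) (All.map inverses (reps-inverse k p))

  hits : ℕ → ℤ → ℕ
  hits k y = ∑[ p ← reps k ] indicator (act (proj₂ p) (+ suc (suc k)) ℤ.≟ y)

  -- Among the inverses of the terms of Ψ_{k+2}, 1 fixes k+3, r⁻¹ s_{k+2} sends k+3 where r⁻¹ sends
  -- k+2, and t (k+2) sends k+3 to −(k+3).
  hits-suc : ∀ k → suc (suc k) < N → ∀ y →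
    hits (suc k) y ≡
    indicator (+ suc (suc (suc k)) ℤ.≟ y) + (hits k y + indicator (-[1+ suc (suc k) ] ℤ.≟ y))
  hits-suc k p y = cong₂ _+_ (cong (λ z → indicator (z ℤ.≟ y)) (act-idₛ (suc (suc k)) p))
    (trans (∑-++ (L.map (mul-s (suc (suc k))) (reps k)) _ _)
      (cong₂ _+_ (trans (∑-map (mul-s (suc (suc k))) (reps k) _) (∑-cong (reps k) λ q →
                   cong (λ z → indicator (z ℤ.≟ y)) (moved-down (proj₂ q))))
                 (trans (ℕP.+-identityʳ _) (cong (λ z → indicator (z ℤ.≟ y)) (t-top (suc k) p)))))
    where
    moved-down : ∀ r' → act (r' ∘ₛ s (suc (suc k))) (+ suc (suc (suc k))) ≡ act r' (+ suc (suc k))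
    moved-down r' = trans (act-∘ₛ r' (s (suc (suc k))) (+ suc (suc (suc k))))
      (cong (act r') (trans (act-s (suc k) (suc (suc k)) p) (cong (+_ ∘ suc) (swap-right (suc k)))))

  hits-beyond : ∀ k → suc k < N → ∀ m → suc k < m → hits k (+ suc m) ≡ 0 × hits k -[1+ m ] ≡ 0
  hits-beyond zero _ (suc zero) (s≤s ())
  hits-beyond zero _ (suc (suc m)) _ = refl , refl
  hits-beyond (suc k) p m k<m =
      trans (hits-suc k p (+ suc m)) (cong₂ _+_
        (indicator-no (m≢ ∘ sym ∘ ℤP.+[1+-injective) (+ suc (suc (suc k)) ℤ.≟ + suc m))
        (cong₂ _+_ (proj₁ IH) (indicator-no (λ ()) (-[1+ suc (suc k) ] ℤ.≟ + suc m))))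
    , trans (hits-suc k p -[1+ m ]) (cong₂ _+_
        (indicator-no (λ ()) (+ suc (suc (suc k)) ℤ.≟ -[1+ m ]))
        (cong₂ _+_ (proj₂ IH)
                   (indicator-no (m≢ ∘ sym ∘ ℤP.-[1+-injective) (-[1+ suc (suc k) ] ℤ.≟ -[1+ m ]))))
    where
    IH = hits-beyond k (ℕP.<⇒≤ p) m (ℕP.<⇒≤ k<m)
    m≢ : m ≢ suc (suc k)
    m≢ refl = ℕP.<-irrefl refl k<m

  hits-once : ∀ k → suc k < N → ∀ {y} → y ∈± suc (suc k) → hits k y ≡ 1
  hits-once zero _ (pos {zero} _) = refl
  hits-once zero _ (pos {suc zero} _) = refl
  hits-once zero _ (pos {suc (suc _)} (s≤s (s≤s ())))
  hits-once zero _ (neg {zero} _) = refl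
  hits-once zero _ (neg {suc zero} _) = refl
  hits-once zero _ (neg {suc (suc _)} (s≤s (s≤s ())))
  hits-once (suc k) p (pos {m} q) with ℕP.m≤n⇒m<n∨m≡n (ℕP.≤-pred q)
  ... | inj₁ m<2+k = trans (hits-suc k p _) (cong₂ _+_
          (indicator-no (λ e → ℕP.<-irrefl (sym (ℤP.+[1+-injective e)) m<2+k)
                        (+ suc (suc (suc k)) ℤ.≟ + suc m))
          (cong₂ _+_ (hits-once k (ℕP.<⇒≤ p) (pos m<2+k))
                     (indicator-no (λ ()) (-[1+ suc (suc k) ] ℤ.≟ + suc m))))
  ... | inj₂ refl = trans (hits-suc k p _) (cong₂ _+_
          (indicator-yes refl (+ suc m ℤ.≟ + suc m))
          (cong₂ _+_ (proj₁ (hits-beyond k (ℕP.<⇒≤ p) _ (ℕP.n<1+n _)))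
                     (indicator-no (λ ()) (-[1+ m ] ℤ.≟ + suc m))))
  hits-once (suc k) p (neg {m} q) with ℕP.m≤n⇒m<n∨m≡n (ℕP.≤-pred q)
  ... | inj₁ m<2+k = trans (hits-suc k p _) (cong₂ _+_
          (indicator-no (λ ()) (+ suc (suc (suc k)) ℤ.≟ -[1+ m ]))
          (cong₂ _+_ (hits-once k (ℕP.<⇒≤ p) (neg m<2+k))
                     (indicator-no (λ e → ℕP.<-irrefl (sym (ℤP.-[1+-injective e)) m<2+k)
                                   (-[1+ suc (suc k) ] ℤ.≟ -[1+ m ]))))
  ... | inj₂ refl = trans (hits-suc k p _) (cong₂ _+_
          (indicator-no (λ ()) (+ suc (suc m) ℤ.≟ -[1+ m ]))
          (cong₂ _+_ (proj₂ (hits-beyond k (ℕP.<⇒≤ p) _ (ℕP.n<1+n _)))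
                     (indicator-yes refl (-[1+ m ] ℤ.≟ -[1+ m ]))))

  InD[]-shift : ∀ {k r r' w y₀} → suc k < N → InversePair (suc k) r r' → InD[ suc k ] w →
    act w y₀ ≡ + suc (suc k) → act r' (+ suc (suc k)) ≡ y₀ → InD[ k ] (w ∘ₛ r')
  InD[]-shift {k} {r' = r'} {w} p ip d wy₀≡ r'≡y₀ with proj₂ (stable ip (suc k) ℕP.≤-refl p) w d
  ... | d' fixing fixes = d' fixing fixes′
    where
    fixes′ : ∀ m → k < m → m < N → act (w ∘ₛ r') (+ suc m) ≡ + suc m
    fixes′ m k<m m<N with ℕP.m≤n⇒m<n∨m≡n k<m
    ... | inj₁ 1+k<m = fixes m 1+k<m m<N
    ... | inj₂ refl = trans (act-∘ₛ w r' (+ suc (suc k))) (trans (cong (act w) r'≡y₀) wy₀≡)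

  InD[]-shift-unique : ∀ {k r r' w y₀} → suc k < N → InversePair (suc k) r r' → InD[ suc k ] w →
    y₀ ∈± N → act w y₀ ≡ + suc (suc k) → InD[ k ] (w ∘ₛ r') → act r' (+ suc (suc k)) ≡ y₀
  InD[]-shift-unique {k} {r' = r'} {w} {y₀} p ip d y₀∈ wy₀≡ d' =
    act-cancel (InD[_].inD d) (maps' ip _ (pos p)) y₀∈ (begin
      act w (act r' (+ suc (suc k)))  ≡⟨ act-∘ₛ w r' (+ suc (suc k)) ⟨
      act (w ∘ₛ r') (+ suc (suc k))   ≡⟨ InD[_].fixes d' (suc k) (ℕP.n<1+n k) p ⟩
      + suc (suc k)                   ≡⟨ wy₀≡ ⟨
      act w y₀                        ∎)
    where open ≡-Reasoning

  InD[]-unshift : ∀ {k r r' w} → suc k < N → InversePair (suc k) r r' →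
    InD[ k ] (w ∘ₛ r') → InD[ suc k ] w
  InD[]-unshift {k} {r} {r'} {w} p ip d' =
    subst InD[ suc k ] (∘ₛ-cancelʳ (Inverses-sym (inverses ip)) w)
      (proj₁ (stable ip (suc k) ℕP.≤-refl p) (w ∘ₛ r') (InD[]-suc d'))

  Counts : ℕ → Set
  Counts K = ∀ w →
    (InD[ K ] w → multiplicity w (terms K) ≡ 1) × (¬ InD[ K ] w → multiplicity w (terms K) ≡ 0)

  counts-zero : Counts 0
  counts-zero w =
      (λ d → cong (λ z → z + 0) (indicator-yes (sym (InD[0]⇒idₛ w d)) (idₛ ≟ₛ w)))
    , (λ ¬d → cong (λ z → z + 0)
         (indicator-no (λ id≡w → ¬d (subst InD[ 0 ] id≡w (InD[]-idₛ 0))) (idₛ ≟ₛ w)))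

  -- The term r contributes w r⁻¹ ∈ D_{k+1} exactly when r⁻¹(k+2) = w⁻¹(k+2).
  counts-suc : ∀ k → suc k < N → Counts k → Counts (suc k)
  counts-suc k p IH w = inside , outside
    where
    pairs = reps-inverse k p
    inside : InD[ suc k ] w → multiplicity w (terms (suc k)) ≡ 1
    inside d with preimage-top p d
    ... | y₀ , y₀∈ , wy₀≡ = begin
      multiplicity w (terms (suc k))                            ≡⟨ multiplicity-step k p w ⟩
      ∑[ q ← reps k ] multiplicity (w ∘ₛ proj₂ q) (terms k)     ≡⟨ ∑-cong-All pairs term ⟩
      hits k y₀                                                 ≡⟨ hits-once k p y₀∈ ⟩
      1                                                         ∎
      where
      open ≡-Reasoning
      term : ∀ {q} → uncurry (InversePair (suc k)) q →
        multiplicity (w ∘ₛ proj₂ q) (terms k) ≡ indicator (act (proj₂ q) (+ suc (suc k)) ℤ.≟ y₀)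
      term {r , r'} ip with act r' (+ suc (suc k)) ℤ.≟ y₀
      ... | yes r'≡y₀ = proj₁ (IH (w ∘ₛ r')) (InD[]-shift p ip d wy₀≡ r'≡y₀)
      ... | no r'≢y₀ = proj₂ (IH (w ∘ₛ r'))
        (r'≢y₀ ∘ InD[]-shift-unique p ip d (∈±-mono p y₀∈) wy₀≡)
    outside : ¬ InD[ suc k ] w → multiplicity w (terms (suc k)) ≡ 0
    outside ¬d = begin
      multiplicity w (terms (suc k))                            ≡⟨ multiplicity-step k p w ⟩
      ∑[ q ← reps k ] multiplicity (w ∘ₛ proj₂ q) (terms k)     ≡⟨ ∑-cong-All pairs term ⟩
      ∑[ q ← reps k ] 0                                         ≡⟨ ∑-zero (reps k) ⟩
      0                                                         ∎
      where
      open ≡-Reasoning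
      term : ∀ {q} → uncurry (InversePair (suc k)) q → multiplicity (w ∘ₛ proj₂ q) (terms k) ≡ 0
      term ip = proj₂ (IH _) (¬d ∘ InD[]-unshift p ip)

  counts : ∀ K → K < N → Counts K
  counts zero _ = counts-zero
  counts (suc k) p = counts-suc k p (counts k (ℕP.<⇒≤ p))

proposition4p1 : (n : ℕ) → 4 ≤ n → (w : SP n) →
    (InD w → coeff (prodΨ {n} (n ∸ 1)) w ≡ + 1) ×
    (¬ InD w → coeff (prodΨ {n} (n ∸ 1)) w ≡ + 0)
proposition4p1 (suc zero) (s≤s ()) w
proposition4p1 (suc (suc n′)) _ w =
    (λ w∈D → trans coeff≡ (cong +_ (proj₁ (counts-top w) (InD→InD′ w w∈D fixing beyond-top))))
  , (λ w∉D → trans coeff≡ (cong +_ (proj₂ (counts-top w) (w∉D ∘ InD′→InD w ∘ InD[_].inD))))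
  where
  open Rank n′
  top = suc n′
  coeff≡ : coeff (prodΨ {N} top) w ≡ + multiplicity w (terms top)
  coeff≡ = trans (cong (λ z → coeff z w) (prodΨ≡terms top)) (coeff-ones (terms top) w)
  counts-top : Counts top
  counts-top = counts top ℕP.≤-refl
  beyond-top : ∀ m → top < m → m < N → act w (+ suc m) ≡ + suc m
  beyond-top m top<m m<N = ⊥-elim (ℕP.<⇒≱ m<N top<m)
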